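{- Let $T:\mathbb{R}[x]\to\mathbb{R}[x]$ be the factorial derivative operator. Then for every $n\in\mathbb{N}$, \[ T(x^n)=1+x+\cdots+x^{n-1}=\sum_{k=0}^{n-1}x^k \] (in particular $T(1)=0$).
   Context: $\mathbb{N}=\{0,1,2,\dots\}$. The Aigner basis of $\mathbb{R}[x]$ is the sequence of polynomials $p_0(x)=1$ and $p_n(x)=x(x-1)^{n-1}$ for $n\geq 1$; since $\deg p_n=n$, it is a basis of $\mathbb{R}[x]$. The factorial derivative operator is the unique linear operator $T:\mathbb{R}[x]\to\mathbb{R}[x]$ with $T(p_0)=0$ and $T(p_n)=p_{n-1}$ for all $n\geq 1$. -}

module Defs where

open import Algebra.Bundles using (CommutativeRing)
open import Data.List using (List; []; _∷_; map)
open import Data.Nat using (ℕ; zero; suc)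
open import Data.Product using (_×_)
open import Level using (_⊔_)

-- Polynomials in one variable x over a commutative ring R, represented by
-- coefficient lists (constant term first). Two lists denote the same
-- polynomial iff all their coefficients agree (trailing zeros ignored).
module Poly {c ℓ} (R : CommutativeRing c ℓ) where
  open CommutativeRing R hiding (zero)

  Pol : Set c
  Pol = List Carrier

  coeff : Pol → ℕ → Carrier
  coeff []      _       = 0#
  coeff (a ∷ p) zero    = a
  coeff (a ∷ p) (suc i) = coeff p i

  infix 4 _≈ₚ_
  _≈ₚ_ : Pol → Pol → Set ℓ
  p ≈ₚ q = ∀ i → coeff p i ≈ coeff q i

  infixl 6 _+ₚ_
  _+ₚ_ : Pol → Pol → Pol
  []      +ₚ q       = q
  (a ∷ p) +ₚ []      = a ∷ p
  (a ∷ p) +ₚ (b ∷ q) = (a + b) ∷ (p +ₚ q)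

  infixr 7 _·ₚ_
  _·ₚ_ : Carrier → Pol → Pol
  a ·ₚ p = map (a *_) p

  infixl 7 _*ₚ_
  _*ₚ_ : Pol → Pol → Pol
  []      *ₚ q = []
  (a ∷ p) *ₚ q = (a ·ₚ q) +ₚ (0# ∷ (p *ₚ q))

  0ₚ : Pol
  0ₚ = []

  1ₚ : Pol
  1ₚ = 1# ∷ []

  X : Pol
  X = 0# ∷ 1# ∷ []

  X-1 : Pol
  X-1 = (- 1#) ∷ 1# ∷ []

  infixr 8 _^ₚ_
  _^ₚ_ : Pol → ℕ → Pol
  p ^ₚ zero  = 1ₚ
  p ^ₚ suc n = p *ₚ (p ^ₚ n)

  aigner : ℕ → Pol
  aigner zero    = 1ₚ
  aigner (suc n) = X *ₚ (X-1 ^ₚ n)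

  record IsLinear (T : Pol → Pol) : Set (c ⊔ ℓ) where
    field
      T-cong      : ∀ {p q} → p ≈ₚ q → T p ≈ₚ T q
      additive    : ∀ p q → T (p +ₚ q) ≈ₚ T p +ₚ T q
      homogeneous : ∀ a p → T (a ·ₚ p) ≈ₚ a ·ₚ T p

  IsFactorialDerivative : (Pol → Pol) → Set (c ⊔ ℓ)
  IsFactorialDerivative T =
    IsLinear T × (T (aigner zero) ≈ₚ 0ₚ) × (∀ n → T (aigner (suc n)) ≈ₚ aigner n)

  geomSum : ℕ → Pol
  geomSum zero    = 0ₚ
  geomSum (suc n) = geomSum n +ₚ (X ^ₚ n)

-- Since x = (x - 1) + 1, multiplication by x acts on the Aigner basis by
-- x pₙ₊₁ = pₙ₊₂ + pₙ₊₁. Applying T and inducting on m gives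
-- T(x^m pₙ₊₂) = x^m pₙ₊₁. As x^(m+2) = x^m (x p₁) = x^m p₂ + x^m p₁, this yields
-- T(x^(m+2)) = x^(m+1) + T(x^(m+1)), and T(x) = T(p₁) = 1 starts the induction.
module Submission where

open import Defs
open import Algebra.Bundles using (CommutativeRing)
open import Data.Nat using (ℕ; zero; suc)
open import Data.List using ([]; _∷_)
open import Data.Product using (_,_)
open import Relation.Binary.Bundles using (Setoid)
open import Relation.Binary.PropositionalEquality as ≡ using (_≡_)
import Algebra.Properties.Ring as RingProperties
import Relation.Binary.Reasoning.Setoid as SetoidReasoning

module FactorialDerivative {c ℓ} (R : CommutativeRing c ℓ) where
  open CommutativeRing R hiding (zero)
  open RingProperties ring using (-1*x≈-x)
  open Poly R

  -- _≈ₚ_ unfolds to a Π-type over the non-injective coeff, so Agda cannot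
  -- infer polynomials from its proofs; this wrapper restores inference.
  infix 4 _≋_
  record _≋_ (p q : Pol) : Set ℓ where
    constructor coeffwise
    field coeff-≈ : p ≈ₚ q
  open _≋_

  ≋-setoid : Setoid c ℓ
  ≋-setoid = record
    { Carrier       = Pol
    ; _≈_           = _≋_
    ; isEquivalence = record
      { refl  = coeffwise λ _ → refl
      ; sym   = λ (coeffwise p≈q) → coeffwise λ i → sym (p≈q i)
      ; trans = λ (coeffwise p≈q) (coeffwise q≈r) → coeffwise λ i → trans (p≈q i) (q≈r i)
      }
    }

  open Setoid ≋-setoid using () renaming (refl to ≋-refl; sym to ≋-sym)

  coeff-+ₚ : ∀ p q i → coeff (p +ₚ q) i ≈ coeff p i + coeff q i
  coeff-+ₚ []      q       i       = sym (+-identityˡ _)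
  coeff-+ₚ (a ∷ p) []      i       = sym (+-identityʳ _)
  coeff-+ₚ (a ∷ p) (b ∷ q) zero    = refl
  coeff-+ₚ (a ∷ p) (b ∷ q) (suc i) = coeff-+ₚ p q i

  coeff-·ₚ : ∀ a p i → coeff (a ·ₚ p) i ≈ a * coeff p i
  coeff-·ₚ a []      i       = sym (zeroʳ a)
  coeff-·ₚ a (b ∷ p) zero    = refl
  coeff-·ₚ a (b ∷ p) (suc i) = coeff-·ₚ a p i

  +ₚ-cong : ∀ {p p′ q q′} → p ≋ p′ → q ≋ q′ → p +ₚ q ≋ p′ +ₚ q′
  +ₚ-cong {p} {p′} {q} {q′} (coeffwise p≈p′) (coeffwise q≈q′) = coeffwise λ i →
    trans (coeff-+ₚ p q i) (trans (+-cong (p≈p′ i) (q≈q′ i)) (sym (coeff-+ₚ p′ q′ i)))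

  +ₚ-comm : ∀ p q → p +ₚ q ≋ q +ₚ p
  +ₚ-comm p q = coeffwise λ i →
    trans (coeff-+ₚ p q i) (trans (+-comm _ _) (sym (coeff-+ₚ q p i)))

  shift : Pol → Pol
  shift q = 0# ∷ q

  shift-cong : ∀ {p q} → p ≋ q → shift p ≋ shift q
  shift-cong (coeffwise p≈q) = coeffwise λ where
    zero    → refl
    (suc i) → p≈q i

  shift-+ₚ : ∀ p q → shift (p +ₚ q) ≋ shift p +ₚ shift q
  shift-+ₚ p q = coeffwise λ where
    zero    → sym (+-identityˡ 0#)
    (suc i) → refl

  shift-0ₚ : shift 0ₚ ≋ 0ₚ
  shift-0ₚ = coeffwise λ where
    zero    → refl
    (suc i) → refl

  module _ where
    open SetoidReasoning setoid

    *ₚ-identityˡ : ∀ q → 1ₚ *ₚ q ≋ q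
    *ₚ-identityˡ q = coeffwise λ i → begin
      coeff (1# ·ₚ q +ₚ shift 0ₚ) i   ≈⟨ coeff-+ₚ (1# ·ₚ q) (shift 0ₚ) i ⟩
      coeff (1# ·ₚ q) i + coeff (shift 0ₚ) i
        ≈⟨ +-cong (coeff-·ₚ 1# q i) (coeff-≈ shift-0ₚ i) ⟩
      1# * coeff q i + 0#             ≈⟨ +-identityʳ _ ⟩
      1# * coeff q i                  ≈⟨ *-identityˡ _ ⟩
      coeff q i                       ∎

    X*ₚ≋shift : ∀ q → X *ₚ q ≋ shift q
    X*ₚ≋shift q = coeffwise λ i → begin
      coeff (0# ·ₚ q +ₚ shift (1ₚ *ₚ q)) i ≈⟨ coeff-+ₚ (0# ·ₚ q) (shift (1ₚ *ₚ q)) i ⟩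
      coeff (0# ·ₚ q) i + coeff (shift (1ₚ *ₚ q)) i
        ≈⟨ +-cong (coeff-·ₚ 0# q i) (coeff-≈ (shift-cong (*ₚ-identityˡ q)) i) ⟩
      0# * coeff q i + coeff (shift q) i   ≈⟨ +-congʳ (zeroˡ _) ⟩
      0# + coeff (shift q) i               ≈⟨ +-identityˡ _ ⟩
      coeff (shift q) i                    ∎

    X-1*ₚ+ₚ≋shift : ∀ q → X-1 *ₚ q +ₚ q ≋ shift q
    X-1*ₚ+ₚ≋shift q = coeffwise λ i →
      let a = coeff q i
          b = coeff (shift q) i
      in begin
      coeff (X-1 *ₚ q +ₚ q) i                 ≈⟨ coeff-+ₚ (X-1 *ₚ q) q i ⟩
      coeff (- 1# ·ₚ q +ₚ shift (1ₚ *ₚ q)) i + a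
        ≈⟨ +-congʳ (coeff-+ₚ (- 1# ·ₚ q) (shift (1ₚ *ₚ q)) i) ⟩
      (coeff (- 1# ·ₚ q) i + coeff (shift (1ₚ *ₚ q)) i) + a
        ≈⟨ +-congʳ (+-cong (coeff-·ₚ (- 1#) q i) (coeff-≈ (shift-cong (*ₚ-identityˡ q)) i)) ⟩
      (- 1# * a + b) + a                      ≈⟨ +-congʳ (+-congʳ (-1*x≈-x a)) ⟩
      (- a + b) + a                           ≈⟨ +-congʳ (+-comm (- a) b) ⟩
      (b - a) + a                             ≈⟨ +-assoc b (- a) a ⟩
      b + (- a + a)                           ≈⟨ +-congˡ (-‿inverseˡ a) ⟩
      b + 0#                                  ≈⟨ +-identityʳ b ⟩
      b                                       ∎

  open SetoidReasoning ≋-setoid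

  shift-aigner : ∀ n → shift (aigner (suc n)) ≋ aigner (suc (suc n)) +ₚ aigner (suc n)
  shift-aigner n = begin
    shift (X *ₚ r)                    ≈⟨ shift-cong (X*ₚ≋shift r) ⟩
    shift (shift r)                   ≈⟨ shift-cong (X-1*ₚ+ₚ≋shift r) ⟨
    shift (X-1 *ₚ r +ₚ r)             ≈⟨ shift-+ₚ (X-1 *ₚ r) r ⟩
    shift (X-1 *ₚ r) +ₚ shift r       ≈⟨ +ₚ-cong (X*ₚ≋shift (X-1 *ₚ r)) (X*ₚ≋shift r) ⟨
    X *ₚ (X-1 *ₚ r) +ₚ X *ₚ r         ∎
    where
    r = X-1 ^ₚ n

  -- Multiplication by x^m. Recursing on the inside makes
  -- shiftBy (suc m) q = shiftBy m (shift q) hold definitionally.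
  shiftBy : ℕ → Pol → Pol
  shiftBy zero    q = q
  shiftBy (suc m) q = shiftBy m (shift q)

  shiftBy-cong : ∀ m {p q} → p ≋ q → shiftBy m p ≋ shiftBy m q
  shiftBy-cong zero    p≋q = p≋q
  shiftBy-cong (suc m) p≋q = shiftBy-cong m (shift-cong p≋q)

  shiftBy-+ₚ : ∀ m p q → shiftBy m (p +ₚ q) ≋ shiftBy m p +ₚ shiftBy m q
  shiftBy-+ₚ zero    p q = ≋-refl
  shiftBy-+ₚ (suc m) p q = begin
    shiftBy m (shift (p +ₚ q))                  ≈⟨ shiftBy-cong m (shift-+ₚ p q) ⟩
    shiftBy m (shift p +ₚ shift q)              ≈⟨ shiftBy-+ₚ m (shift p) (shift q) ⟩
    shiftBy m (shift p) +ₚ shiftBy m (shift q)  ∎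

  shiftBy-shift : ∀ m q → shiftBy m (shift q) ≡ shift (shiftBy m q)
  shiftBy-shift zero    q = ≡.refl
  shiftBy-shift (suc m) q = shiftBy-shift m (shift q)

  X^ₚ≋shiftBy : ∀ m → X ^ₚ m ≋ shiftBy m 1ₚ
  X^ₚ≋shiftBy zero    = ≋-refl
  X^ₚ≋shiftBy (suc m) = begin
    X *ₚ X ^ₚ m              ≈⟨ X*ₚ≋shift (X ^ₚ m) ⟩
    shift (X ^ₚ m)           ≈⟨ shift-cong (X^ₚ≋shiftBy m) ⟩
    shift (shiftBy m 1ₚ)     ≡⟨ shiftBy-shift m 1ₚ ⟨
    shiftBy m (shift 1ₚ)     ∎

  X^ₚsuc≋shiftBy-aigner₁ : ∀ m → X ^ₚ suc m ≋ shiftBy m (aigner 1)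
  X^ₚsuc≋shiftBy-aigner₁ m = begin
    X ^ₚ suc m               ≈⟨ X^ₚ≋shiftBy (suc m) ⟩
    shiftBy m (shift 1ₚ)     ≈⟨ shiftBy-cong m (X*ₚ≋shift 1ₚ) ⟨
    shiftBy m (X *ₚ 1ₚ)      ∎

  shiftBy-aigner : ∀ m n →
    shiftBy (suc m) (aigner (suc n)) ≋
      shiftBy m (aigner (suc (suc n))) +ₚ shiftBy m (aigner (suc n))
  shiftBy-aigner m n = begin
    shiftBy m (shift (aigner (suc n)))                  ≈⟨ shiftBy-cong m (shift-aigner n) ⟩
    shiftBy m (aigner (suc (suc n)) +ₚ aigner (suc n))  ≈⟨ shiftBy-+ₚ m _ _ ⟩
    shiftBy m (aigner (suc (suc n))) +ₚ shiftBy m (aigner (suc n)) ∎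

  module _ (T : Pol → Pol) (T-linear : IsLinear T)
           (T-aigner-suc : ∀ n → T (aigner (suc n)) ≈ₚ aigner n) where

    T-cong : ∀ {p q} → p ≋ q → T p ≋ T q
    T-cong (coeffwise p≈q) = coeffwise (IsLinear.T-cong T-linear p≈q)

    T-+ₚ : ∀ p q → T (p +ₚ q) ≋ T p +ₚ T q
    T-+ₚ p q = coeffwise (IsLinear.additive T-linear p q)

    T-shiftBy-aigner : ∀ m n →
      T (shiftBy m (aigner (suc (suc n)))) ≋ shiftBy m (aigner (suc n))
    T-shiftBy-aigner zero    n = coeffwise (T-aigner-suc (suc n))
    T-shiftBy-aigner (suc m) n = begin
      T (shiftBy (suc m) (aigner (suc (suc n))))
        ≈⟨ T-cong (shiftBy-aigner m (suc n)) ⟩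
      T (shiftBy m (aigner (suc (suc (suc n)))) +ₚ shiftBy m (aigner (suc (suc n))))
        ≈⟨ T-+ₚ _ _ ⟩
      T (shiftBy m (aigner (suc (suc (suc n))))) +ₚ T (shiftBy m (aigner (suc (suc n))))
        ≈⟨ +ₚ-cong (T-shiftBy-aigner m (suc n)) (T-shiftBy-aigner m n) ⟩
      shiftBy m (aigner (suc (suc n))) +ₚ shiftBy m (aigner (suc n))
        ≈⟨ shiftBy-aigner m n ⟨
      shiftBy (suc m) (aigner (suc n)) ∎

    T-X^ₚsuc : ∀ m → T (X ^ₚ suc m) ≋ geomSum (suc m)
    T-X^ₚsuc zero    = begin
      T (X ^ₚ 1)   ≈⟨ T-cong (X^ₚsuc≋shiftBy-aigner₁ 0) ⟩
      T (aigner 1) ≈⟨ coeffwise (T-aigner-suc 0) ⟩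
      aigner 0     ∎
    T-X^ₚsuc (suc m) = begin
      T (X ^ₚ suc (suc m))
        ≈⟨ T-cong (X^ₚsuc≋shiftBy-aigner₁ (suc m)) ⟩
      T (shiftBy (suc m) (aigner 1))
        ≈⟨ T-cong (shiftBy-aigner m 0) ⟩
      T (shiftBy m (aigner 2) +ₚ shiftBy m (aigner 1))
        ≈⟨ T-+ₚ _ _ ⟩
      T (shiftBy m (aigner 2)) +ₚ T (shiftBy m (aigner 1))
        ≈⟨ +ₚ-cong (T-shiftBy-aigner m 0) (T-cong (≋-sym (X^ₚsuc≋shiftBy-aigner₁ m))) ⟩
      shiftBy m (aigner 1) +ₚ T (X ^ₚ suc m)
        ≈⟨ +ₚ-cong (≋-sym (X^ₚsuc≋shiftBy-aigner₁ m)) (T-X^ₚsuc m) ⟩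
      X ^ₚ suc m +ₚ geomSum (suc m)
        ≈⟨ +ₚ-comm (X ^ₚ suc m) (geomSum (suc m)) ⟩
      geomSum (suc (suc m)) ∎

mainTheorem1 : ∀ {c ℓ} (R : CommutativeRing c ℓ) → let open Poly R in
    (T : Pol → Pol) → IsFactorialDerivative T →
    (n : ℕ) → T (X ^ₚ n) ≈ₚ geomSum n
mainTheorem1 R T (T-linear , T-aigner₀ , T-aigner-suc) zero    = T-aigner₀
mainTheorem1 R T (T-linear , T-aigner₀ , T-aigner-suc) (suc n) =
  _≋_.coeff-≈ (T-X^ₚsuc T T-linear T-aigner-suc n)
  where open FactorialDerivative R
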